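{- There exist constants $c>0$ and $\epsilon_0>0$ such that for every $\epsilon\in(0,\epsilon_0)$, every online algorithm for the lax static case of \textsc{SubsetSum} with competitive ratio $1-\epsilon$ has amortized migration factor at least $c/\epsilon$ on some online instance.
   Context: \textsc{SubsetSum}: a fixed capacity $C\in\mathbb N$ and items with sizes $s_i\in\mathbb N$; a subset is feasible iff its total size is at most $C$, and its profit is its total size. Lax static case: at time $1$ an arbitrary (possibly non-empty) instance $I_1$ is presented, contributing no migration potential. Afterwards, at each time step exactly one item arrives, and items never depart. The online algorithm outputs at every time $t$ a feasible subset $S_t$ without knowledge of the future. Competitive ratio $1-\epsilon$ means $\mathrm{profit}(S_t)\ge(1-\epsilon)\mathrm{opt}(I_t)$ for all $t$. The migration potential of a step $t\ge2$ is the size of the arriving item. The migration cost of changing $S_{t-1}$ to $S_t$ is the total size of $S_{t-1}\triangle S_t$, excluding the newly arrived item; the solution $S_1$ is free. The amortized migration factor is the maximum over $t$ of (total migration cost up to $t$)/(total migration potential up to $t$).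
   Formalization: The parameter ε ranges only over rational numbers in $(0,\epsilon_0)$. -}

module Defs where

open import Data.Nat using (ℕ; zero; suc; _+_; _⊔_; _≤_; _≤ᵇ_)
open import Data.Bool using (Bool; true; false; if_then_else_)
open import Data.Vec using (Vec; []; _∷_; _++_; tail)
open import Data.List using (List; []; _∷_; map; foldr; concatMap)
open import Data.Integer using (+_)
open import Data.Rational using (ℚ; _/_)

toℚ : ℕ → ℚ
toℚ n = + n / 1

selSize : {n : ℕ} → Vec ℕ n → Vec Bool n → ℕ
selSize []       []           = 0
selSize (x ∷ xs) (true  ∷ S)  = x + selSize xs S
selSize (x ∷ xs) (false ∷ S)  = selSize xs S

diffSize : {n : ℕ} → Vec ℕ n → Vec Bool n → Vec Bool n → ℕ
diffSize []       []          []          = 0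
diffSize (x ∷ xs) (true  ∷ S) (false ∷ T) = x + diffSize xs S T
diffSize (x ∷ xs) (false ∷ S) (true  ∷ T) = x + diffSize xs S T
diffSize (x ∷ xs) (_     ∷ S) (_     ∷ T) = diffSize xs S T

Feasible : ℕ → {n : ℕ} → Vec ℕ n → Vec Bool n → Set
Feasible C xs S = selSize xs S ≤ C

subsets : (n : ℕ) → List (Vec Bool n)
subsets zero    = [] ∷ []
subsets (suc n) = concatMap (λ S → (true ∷ S) ∷ (false ∷ S) ∷ []) (subsets n)

opt : ℕ → {n : ℕ} → Vec ℕ n → ℕ
opt C {n} xs =
  foldr _⊔_ 0 (map (λ S → if selSize xs S ≤ᵇ C then selSize xs S else 0) (subsets n))

-- History at time t = 1 + k: capacity C, initial instance I₁ (a Vec of m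
-- sizes) and the k arrived items, stored NEWEST FIRST (head = latest arrival).
-- The current instance I_t is  arrivals ++ initial  (newest first), and the
-- algorithm outputs a selection over exactly these items.  Being a function of
-- the history only, it has no knowledge of the future.
OnlineAlg : Set
OnlineAlg = (C : ℕ) → {m : ℕ} → Vec ℕ m → {k : ℕ} → Vec ℕ k → Vec Bool (k + m)

potential : {k : ℕ} → Vec ℕ k → ℕ
potential []        = 0
potential (a ∷ arr) = a + potential arr

-- The step in which item a
-- arrives changes S_old = A C init arr into S_new = A C init (a ∷ arr); its cost
-- is the size of S_old △ S_new excluding the new item (the head position).
migrationCost : OnlineAlg → (C : ℕ) → {m : ℕ} → Vec ℕ m → {k : ℕ} → Vec ℕ k → ℕ
migrationCost A C init []        = 0
migrationCost A C init (a ∷ arr) =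
  migrationCost A C init arr
  + diffSize (arr ++ init) (tail (A C init (a ∷ arr))) (A C init arr)

-- Write ε = n/d with 4n < d.  Under capacity C = d + 4n the instance {d + 2n, d}
-- admits only one of its items, and d < (1 - ε)(d + 2n), so a (1 - ε)-competitive
-- algorithm must pack d + 2n.  After an item of size 4n arrives, {4n, d} fills C
-- exactly, d + 2n < (1 - ε)C and d + 2n fits with no other item, so d + 2n must be
-- dropped: a migration cost of at least d = (1/4ε)·4n for a migration potential of 4n.
module Submission where

open import Defs
open import Data.Bool using (Bool; true; false; if_then_else_)
open import Data.Bool.Properties using (T-≡)
open import Data.Empty using (⊥-elim)
open import Data.Integer as ℤ using (+_; +[1+_]; -[1+_])
import Data.Integer.Properties as ℤ
open import Data.List using (List; map; foldr)
import Data.List as List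
open import Data.List.Membership.Propositional using (_∈_)
open import Data.List.Membership.Propositional.Properties using (∈-concatMap⁺; ∈-map⁺)
import Data.List.Relation.Unary.Any as Any
open Any using (here; there)
open import Data.Nat as ℕ using (ℕ; suc; _<_)
open import Data.Nat.Coprimality using (Coprime)
import Data.Nat.Properties as ℕ
import Data.Nat.Tactic.RingSolver as ℕ-Tactic
open import Data.Product using (Σ; _×_; _,_)
open import Data.Rational
  using (ℚ; mkℚ; 0ℚ; 1ℚ; _+_; _-_; _*_; -_; *<*; nonNegative; toℚᵘ)
  renaming (_<_ to _<ℚ_; _≤_ to _≤ℚ_; _/_ to _/ℚ_)
open import Data.Rational.Properties
  using ( toℚᵘ-injective; toℚᵘ-fromℚᵘ; toℚᵘ-homo-+; toℚᵘ-homo-*; toℚᵘ-mono-≤; toℚᵘ-cancel-≤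
        ; +-monoˡ-≤; +-inverseʳ; *-monoˡ-≤-nonNeg; *-identityˡ; *-assoc; <⇒≤; <-trans; module ≤-Reasoning)
open import Data.Rational.Solver using (module +-*-Solver)
import Data.Rational.Unnormalised as ℚᵘ
import Data.Rational.Unnormalised.Properties as ℚᵘ
open import Data.Vec using (Vec; []; _∷_; _++_; head; tail)
open import Function.Bundles using (Equivalence)
open import Relation.Binary.PropositionalEquality
  using (_≡_; refl; sym; trans; cong; cong₂; subst; subst₂)
open import Relation.Nullary using (¬_)

toℚᵘ-toℚ : ∀ a → toℚᵘ (toℚ a) ℚᵘ.≃ (+ a) ℚᵘ./ 1
toℚᵘ-toℚ a = toℚᵘ-fromℚᵘ ((+ a) ℚᵘ./ 1)

toℚ-homo-+ : ∀ a b → toℚ (a ℕ.+ b) ≡ toℚ a + toℚ b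
toℚ-homo-+ a b = toℚᵘ-injective (begin-equality
  toℚᵘ (toℚ (a ℕ.+ b))             ≃⟨ toℚᵘ-toℚ (a ℕ.+ b) ⟩
  + (a ℕ.+ b) ℚᵘ./ 1               ≃⟨ ℚᵘ.*≡* (cong (ℤ._* + 1) numerators) ⟩
  (+ a ℚᵘ./ 1) ℚᵘ.+ (+ b ℚᵘ./ 1)   ≃⟨ ℚᵘ.+-cong (toℚᵘ-toℚ a) (toℚᵘ-toℚ b) ⟨
  toℚᵘ (toℚ a) ℚᵘ.+ toℚᵘ (toℚ b)   ≃⟨ toℚᵘ-homo-+ (toℚ a) (toℚ b) ⟨
  toℚᵘ (toℚ a + toℚ b)             ∎)
  where
  open ℚᵘ.≤-Reasoning
  numerators : + (a ℕ.+ b) ≡ + a ℤ.* + 1 ℤ.+ + b ℤ.* + 1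
  numerators = trans (ℤ.pos-+ a b) (sym (cong₂ ℤ._+_ (ℤ.*-identityʳ (+ a)) (ℤ.*-identityʳ (+ b))))

toℚ-homo-* : ∀ a b → toℚ (a ℕ.* b) ≡ toℚ a * toℚ b
toℚ-homo-* a b = toℚᵘ-injective (begin-equality
  toℚᵘ (toℚ (a ℕ.* b))             ≃⟨ toℚᵘ-toℚ (a ℕ.* b) ⟩
  + (a ℕ.* b) ℚᵘ./ 1               ≃⟨ ℚᵘ.*≡* (cong (ℤ._* + 1) (ℤ.pos-* a b)) ⟩
  (+ a ℚᵘ./ 1) ℚᵘ.* (+ b ℚᵘ./ 1)   ≃⟨ ℚᵘ.*-cong (toℚᵘ-toℚ a) (toℚᵘ-toℚ b) ⟨
  toℚᵘ (toℚ a) ℚᵘ.* toℚᵘ (toℚ b)   ≃⟨ toℚᵘ-homo-* (toℚ a) (toℚ b) ⟨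
  toℚᵘ (toℚ a * toℚ b)             ∎)
  where open ℚᵘ.≤-Reasoning

toℚ-mono-≤ : ∀ {a b} → a ℕ.≤ b → toℚ a ≤ℚ toℚ b
toℚ-mono-≤ {a} {b} a≤b = toℚᵘ-cancel-≤ (begin
  toℚᵘ (toℚ a)  ≃⟨ toℚᵘ-toℚ a ⟩
  + a ℚᵘ./ 1    ≤⟨ ℚᵘ.*≤* (ℤ.*-monoʳ-≤-nonNeg (+ 1) (ℤ.+≤+ a≤b)) ⟩
  + b ℚᵘ./ 1    ≃⟨ toℚᵘ-toℚ b ⟨
  toℚᵘ (toℚ b)  ∎)
  where open ℚᵘ.≤-Reasoning

toℚ-cancel-≤ : ∀ {a b} → toℚ a ≤ℚ toℚ b → a ℕ.≤ b
toℚ-cancel-≤ {a} {b} a≤b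
  with ℚᵘ.*≤* h ← ℚᵘ.≤-respʳ-≃ (toℚᵘ-toℚ b) (ℚᵘ.≤-respˡ-≃ (toℚᵘ-toℚ a) (toℚᵘ-mono-≤ a≤b))
  = ℤ.drop‿+≤+ (ℤ.*-cancelʳ-≤-pos (+ a) (+ b) (+ 1) h)

¼ : ℚ
¼ = + 1 /ℚ 4

*-denominator≡numerator : ∀ n d-1 .(c : Coprime n (suc d-1)) → mkℚ (+ n) d-1 c * toℚ (suc d-1) ≡ toℚ n
*-denominator≡numerator n d-1 c = toℚᵘ-injective (begin-equality
  toℚᵘ (mkℚ (+ n) d-1 c * toℚ (suc d-1))          ≃⟨ toℚᵘ-homo-* (mkℚ (+ n) d-1 c) (toℚ (suc d-1)) ⟩
  ℚᵘ.mkℚᵘ (+ n) d-1 ℚᵘ.* toℚᵘ (toℚ (suc d-1))     ≃⟨ ℚᵘ.*-congˡ {ℚᵘ.mkℚᵘ (+ n) d-1} (toℚᵘ-toℚ (suc d-1)) ⟩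
  ℚᵘ.mkℚᵘ (+ n) d-1 ℚᵘ.* (+ suc d-1 ℚᵘ./ 1)       ≃⟨ ℚᵘ.*≡* cross ⟩
  + n ℚᵘ./ 1                                      ≃⟨ toℚᵘ-toℚ n ⟨
  toℚᵘ (toℚ n)                                    ∎)
  where
  open ℚᵘ.≤-Reasoning
  cross : (+ n ℤ.* + suc d-1) ℤ.* + 1 ≡ + n ℤ.* + (suc d-1 ℕ.* 1)
  cross = trans (ℤ.*-identityʳ _) (cong (λ m → + n ℤ.* + m) (sym (ℕ.*-identityʳ (suc d-1))))

below-¼⇒fraction : ∀ ε → 0ℚ <ℚ ε → ε <ℚ ¼ → Σ ℕ λ n → Σ ℕ λ d → 0 < n × 4 ℕ.* n < d × ε * toℚ d ≡ toℚ n
below-¼⇒fraction (mkℚ (+ 0) _ _) (*<* (ℤ.+<+ ())) _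
below-¼⇒fraction (mkℚ +[1+ k ] d-1 c) _ (*<* (ℤ.+<+ ε<¼)) =
  suc k , suc d-1 , ℕ.s≤s ℕ.z≤n ,
  subst₂ _<_ (ℕ.*-comm (suc k) 4) (ℕ.*-identityˡ (suc d-1)) ε<¼ ,
  *-denominator≡numerator (suc k) d-1 c
below-¼⇒fraction (mkℚ -[1+ _ ] _ _) (*<* ()) _

∈-subsets : ∀ {n} (S : Vec Bool n) → S ∈ subsets n
∈-subsets []          = here refl
∈-subsets (true ∷ S)  = ∈-concatMap⁺ _ (Any.map (λ { refl → here refl }) (∈-subsets S))
∈-subsets (false ∷ S) = ∈-concatMap⁺ _ (Any.map (λ { refl → there (here refl) }) (∈-subsets S))

∈⇒≤-foldr-⊔ : ∀ {xs : List ℕ} {x} → x ∈ xs → x ℕ.≤ foldr ℕ._⊔_ 0 xs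
∈⇒≤-foldr-⊔ (here refl)  = ℕ.m≤m⊔n _ _
∈⇒≤-foldr-⊔ (there x∈xs) = ℕ.≤-trans (∈⇒≤-foldr-⊔ x∈xs) (ℕ.m≤n⊔m _ _)

feasible⇒≤opt : ∀ C {n} (xs : Vec ℕ n) (S : Vec Bool n) → Feasible C xs S → selSize xs S ℕ.≤ opt C xs
feasible⇒≤opt C {n} xs S feasible =
  ∈⇒≤-foldr-⊔ (subst (_∈ map profit (subsets n)) profit-S (∈-map⁺ profit (∈-subsets S)))
  where
  profit : Vec Bool n → ℕ
  profit S = if selSize xs S ℕ.≤ᵇ C then selSize xs S else 0
  profit-S : profit S ≡ selSize xs S
  profit-S = cong (λ b → if b then selSize xs S else 0) (Equivalence.to T-≡ (ℕ.≤⇒≤ᵇ feasible))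

Competitive : ℚ → ℕ → ∀ {k} → Vec ℕ k → Vec Bool k → Set
Competitive ε C xs S = (1ℚ - ε) * toℚ (opt C xs) ≤ℚ toℚ (selSize xs S)

competitive-mono : ∀ {ε} C {k} (xs : Vec ℕ k) S {a b} → ε ≤ℚ 1ℚ → a ℕ.≤ opt C xs → selSize xs S ℕ.≤ b →
                   Competitive ε C xs S → (1ℚ - ε) * toℚ a ≤ℚ toℚ b
competitive-mono {ε} C xs S {a} {b} ε≤1 a≤opt S≤b competitive = begin
  (1ℚ - ε) * toℚ a            ≤⟨ *-monoˡ-≤-nonNeg (1ℚ - ε) {{nonNegative 0≤1-ε}} (toℚ-mono-≤ a≤opt) ⟩
  (1ℚ - ε) * toℚ (opt C xs)   ≤⟨ competitive ⟩
  toℚ (selSize xs S)          ≤⟨ toℚ-mono-≤ S≤b ⟩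
  toℚ b                       ∎
  where
  open ≤-Reasoning
  0≤1-ε : 0ℚ ≤ℚ 1ℚ - ε
  0≤1-ε = subst (_≤ℚ 1ℚ - ε) (+-inverseʳ ε) (+-monoˡ-≤ (- ε) ε≤1)

module _ (ε : ℚ) (n d : ℕ) (ε*d≡n : ε * toℚ d ≡ toℚ n) where

  ratio-in-ℕ : ∀ a b → (1ℚ - ε) * toℚ a ≤ℚ toℚ b → d ℕ.* a ℕ.≤ d ℕ.* b ℕ.+ n ℕ.* a
  ratio-in-ℕ a b competitive = toℚ-cancel-≤ {d ℕ.* a} {d ℕ.* b ℕ.+ n ℕ.* a} (begin
    toℚ (d ℕ.* a)                                    ≡⟨ toℚ-homo-* d a ⟩
    toℚ d * toℚ a                                    ≡⟨ split ε (toℚ d) (toℚ a) ⟩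
    toℚ d * ((1ℚ - ε) * toℚ a) + ε * toℚ d * toℚ a   ≤⟨ +-monoˡ-≤ (ε * toℚ d * toℚ a) scaled ⟩
    toℚ d * toℚ b + ε * toℚ d * toℚ a                ≡⟨ cong₂ (λ u v → u + v * toℚ a) (sym (toℚ-homo-* d b)) ε*d≡n ⟩
    toℚ (d ℕ.* b) + toℚ n * toℚ a                    ≡⟨ cong (λ u → toℚ (d ℕ.* b) + u) (toℚ-homo-* n a) ⟨
    toℚ (d ℕ.* b) + toℚ (n ℕ.* a)                    ≡⟨ toℚ-homo-+ (d ℕ.* b) (n ℕ.* a) ⟨
    toℚ (d ℕ.* b ℕ.+ n ℕ.* a)                        ∎)
    where
    open ≤-Reasoning
    open +-*-Solver
    split : ∀ e y x → y * x ≡ y * ((1ℚ - e) * x) + e * y * x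
    split = solve 3 (λ e y x → y :* x := y :* ((con 1ℚ :- e) :* x) :+ e :* y :* x) refl
    scaled : toℚ d * ((1ℚ - ε) * toℚ a) ≤ℚ toℚ d * toℚ b
    scaled = *-monoˡ-≤-nonNeg (toℚ d) {{nonNegative (toℚ-mono-≤ {0} {d} ℕ.z≤n)}} competitive

  ratio-gap : ∀ b t → (1ℚ - ε) * toℚ (b ℕ.+ t) ≤ℚ toℚ b → d ℕ.* t ℕ.≤ n ℕ.* (b ℕ.+ t)
  ratio-gap b t competitive = ℕ.+-cancelˡ-≤ (d ℕ.* b) _ _ (begin
    d ℕ.* b ℕ.+ d ℕ.* t           ≡⟨ ℕ.*-distribˡ-+ d b t ⟨
    d ℕ.* (b ℕ.+ t)               ≤⟨ ratio-in-ℕ (b ℕ.+ t) b competitive ⟩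
    d ℕ.* b ℕ.+ n ℕ.* (b ℕ.+ t)   ∎)
    where open ℕ.≤-Reasoning

diffSize-head : ∀ {k} x (xs : Vec ℕ k) S T → head S ≡ false → head T ≡ true → x ℕ.≤ diffSize (x ∷ xs) S T
diffSize-head x xs (false ∷ S) (true ∷ T) refl refl = ℕ.m≤m+n x _

FeasibleAlg : OnlineAlg → Set
FeasibleAlg A = ∀ C {m} (init : Vec ℕ m) {k} (arr : Vec ℕ k) → Feasible C (arr ++ init) (A C init arr)

CompetitiveAlg : ℚ → OnlineAlg → Set
CompetitiveAlg ε A = ∀ C {m} (init : Vec ℕ m) {k} (arr : Vec ℕ k) → Competitive ε C (arr ++ init) (A C init arr)

MigrationFactorAtLeast : ℚ → ℚ → OnlineAlg → Set
MigrationFactorAtLeast c ε A =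
  Σ ℕ λ C → Σ ℕ λ m → Σ (Vec ℕ m) λ init → Σ ℕ λ k → Σ (Vec ℕ k) λ arr →
    0 < potential arr × c * toℚ (potential arr) ≤ℚ ε * toℚ (migrationCost A C init arr)

module Adversary (ε : ℚ) (0≤ε : 0ℚ ≤ℚ ε) (ε≤1 : ε ≤ℚ 1ℚ)
                 (n d : ℕ) (0<n : 0 < n) (4n<d : 4 ℕ.* n < d) (ε*d≡n : ε * toℚ d ≡ toℚ n) where

  instance
    n≢0 : ℕ.NonZero n
    n≢0 = ℕ.>-nonZero 0<n

  W X C s : ℕ
  W = d
  X = d ℕ.+ 2 ℕ.* n
  C = d ℕ.+ 4 ℕ.* n
  s = 4 ℕ.* n

  initial : Vec ℕ 2
  initial = X ∷ W ∷ []

  X+2n≡C : X ℕ.+ 2 ℕ.* n ≡ C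
  X+2n≡C = trans (ℕ.+-assoc d (2 ℕ.* n) (2 ℕ.* n)) (cong (d ℕ.+_) (sym (ℕ.*-distribʳ-+ n 2 2)))

  s+W≡C : s ℕ.+ (W ℕ.+ 0) ≡ C
  s+W≡C = trans (cong (s ℕ.+_) (ℕ.+-identityʳ W)) (ℕ.+-comm s d)

  X-feasible : X ℕ.+ 0 ℕ.≤ C
  X-feasible = subst₂ ℕ._≤_ (sym (ℕ.+-identityʳ X)) X+2n≡C (ℕ.m≤m+n X (2 ℕ.* n))

  X+W-infeasible : ¬ (X ℕ.+ (W ℕ.+ 0) ℕ.≤ C)
  X+W-infeasible = ℕ.<⇒≱ (subst (ℕ._< X ℕ.+ (W ℕ.+ 0)) X+2n≡C (ℕ.+-monoʳ-< X 2n<W))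
    where
    2n<W : 2 ℕ.* n < W ℕ.+ 0
    2n<W = subst (2 ℕ.* n <_) (sym (ℕ.+-identityʳ W)) (ℕ.≤-<-trans (ℕ.*-monoˡ-≤ n {2} {4} (ℕ.s≤s (ℕ.s≤s ℕ.z≤n))) 4n<d)

  s+X-infeasible : ∀ r → ¬ (s ℕ.+ (X ℕ.+ r) ℕ.≤ C)
  s+X-infeasible r = ℕ.<⇒≱ (begin-strict
    C                   ≡⟨ X+2n≡C ⟨
    X ℕ.+ 2 ℕ.* n       <⟨ ℕ.+-monoʳ-< X (ℕ.*-monoˡ-< n {2} {4} (ℕ.s≤s (ℕ.s≤s (ℕ.s≤s ℕ.z≤n)))) ⟩
    X ℕ.+ s             ≡⟨ ℕ.+-comm X s ⟩
    s ℕ.+ X             ≤⟨ ℕ.+-monoʳ-≤ s (ℕ.m≤m+n X r) ⟩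
    s ℕ.+ (X ℕ.+ r)     ∎)
    where open ℕ.≤-Reasoning

  ratio-violated : ∀ b → b ℕ.+ 2 ℕ.* n ℕ.≤ C → ¬ ((1ℚ - ε) * toℚ (b ℕ.+ 2 ℕ.* n) ≤ℚ toℚ b)
  ratio-violated b b+2n≤C competitive = ℕ.<⇒≱ (begin-strict
    n ℕ.* (b ℕ.+ 2 ℕ.* n)   ≤⟨ ℕ.*-monoʳ-≤ n b+2n≤C ⟩
    n ℕ.* C                 <⟨ ℕ.*-monoʳ-< n (ℕ.+-monoʳ-< d 4n<d) ⟩
    n ℕ.* (d ℕ.+ d)         ≡⟨ ℕ-Tactic.solve (n List.∷ d List.∷ List.[]) ⟩
    d ℕ.* (2 ℕ.* n)         ∎) (ratio-gap ε n d ε*d≡n b (2 ℕ.* n) competitive)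
    where open ℕ.≤-Reasoning

  outperformed⇒¬competitive : ∀ {k} (xs : Vec ℕ k) S T b → Feasible C xs T →
                              b ℕ.+ 2 ℕ.* n ℕ.≤ selSize xs T → selSize xs S ℕ.≤ b →
                              ¬ Competitive ε C xs S
  outperformed⇒¬competitive xs S T b T-feasible b+2n≤T S≤b competitive =
    ratio-violated b (ℕ.≤-trans b+2n≤T T-feasible)
      (competitive-mono C xs S ε≤1 (ℕ.≤-trans b+2n≤T (feasible⇒≤opt C xs T T-feasible)) S≤b competitive)

  keeps-X : ∀ S → Feasible C initial S → Competitive ε C initial S → head S ≡ true
  keeps-X (true  ∷ true  ∷ []) feasible _ = ⊥-elim (X+W-infeasible feasible)
  keeps-X (true  ∷ false ∷ []) _ _ = refl
  keeps-X S@(false ∷ true  ∷ []) _ competitive = ⊥-elim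
    (outperformed⇒¬competitive initial S (true ∷ false ∷ []) W X-feasible (ℕ.m≤m+n X 0)
       (ℕ.≤-reflexive (ℕ.+-identityʳ W)) competitive)
  keeps-X S@(false ∷ false ∷ []) _ competitive = ⊥-elim
    (outperformed⇒¬competitive initial S (true ∷ false ∷ []) W X-feasible (ℕ.m≤m+n X 0)
       ℕ.z≤n competitive)

  drops-X : ∀ S → Feasible C (s ∷ initial) S → Competitive ε C (s ∷ initial) S → head (tail S) ≡ false
  drops-X (_     ∷ false ∷ _     ∷ []) _ _ = refl
  drops-X (true  ∷ true  ∷ _     ∷ []) feasible _ = ⊥-elim (s+X-infeasible _ feasible)
  drops-X (false ∷ true  ∷ true  ∷ []) feasible _ = ⊥-elim (X+W-infeasible feasible)
  drops-X S@(false ∷ true  ∷ false ∷ []) _ competitive = ⊥-elim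
    (outperformed⇒¬competitive (s ∷ initial) S (true ∷ false ∷ true ∷ []) X (ℕ.≤-reflexive s+W≡C)
       (ℕ.≤-reflexive (trans X+2n≡C (sym s+W≡C))) (ℕ.≤-reflexive (ℕ.+-identityʳ X)) competitive)

  forced-migration : ∀ A → FeasibleAlg A → CompetitiveAlg ε A → MigrationFactorAtLeast ¼ ε A
  forced-migration A feasible competitive =
    C , 2 , initial , 1 , s ∷ [] , 0<s+0 , bound
    where
    0<s+0 : 0 < s ℕ.+ 0
    0<s+0 = subst (0 <_) (sym (ℕ.+-identityʳ s)) (ℕ.*-monoʳ-< 4 0<n)
    cost : ℕ
    cost = migrationCost A C initial (s ∷ [])
    X≤cost : X ℕ.≤ cost
    X≤cost = diffSize-head X (W ∷ []) (tail S₂) S₁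
      (drops-X S₂ (feasible C initial (s ∷ [])) (competitive C initial (s ∷ [])))
      (keeps-X S₁ (feasible C initial []) (competitive C initial []))
      where
      S₁ = A C initial []
      S₂ = A C initial (s ∷ [])
    bound : ¼ * toℚ (s ℕ.+ 0) ≤ℚ ε * toℚ cost
    -- the step using *-identityˡ holds because the closed term ¼ * toℚ 4 normalises to 1ℚ
    bound = begin
      ¼ * toℚ (s ℕ.+ 0)      ≡⟨ cong (λ m → ¼ * toℚ m) (ℕ.+-identityʳ s) ⟩
      ¼ * toℚ (4 ℕ.* n)      ≡⟨ cong (¼ *_) (toℚ-homo-* 4 n) ⟩
      ¼ * (toℚ 4 * toℚ n)    ≡⟨ *-assoc ¼ (toℚ 4) (toℚ n) ⟨
      ¼ * toℚ 4 * toℚ n      ≡⟨ *-identityˡ (toℚ n) ⟩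
      toℚ n                  ≡⟨ ε*d≡n ⟨
      ε * toℚ d              ≤⟨ *-monoˡ-≤-nonNeg ε {{nonNegative 0≤ε}} (toℚ-mono-≤ (ℕ.≤-trans (ℕ.m≤m+n d (2 ℕ.* n)) X≤cost)) ⟩
      ε * toℚ cost           ∎
      where open ≤-Reasoning

theorem16 :
    Σ ℚ λ c → Σ ℚ λ ε₀ → 0ℚ <ℚ c × 0ℚ <ℚ ε₀ ×
      ((ε : ℚ) → 0ℚ <ℚ ε → ε <ℚ ε₀ →
        (A : OnlineAlg) →
        ((C : ℕ) → {m : ℕ} → (init : Vec ℕ m) → {k : ℕ} → (arr : Vec ℕ k) →
            Feasible C (arr ++ init) (A C init arr)) →
        ((C : ℕ) → {m : ℕ} → (init : Vec ℕ m) → {k : ℕ} → (arr : Vec ℕ k) →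
            (1ℚ - ε) * toℚ (opt C (arr ++ init)) ≤ℚ toℚ (selSize (arr ++ init) (A C init arr))) →
        Σ ℕ λ C → Σ ℕ λ m → Σ (Vec ℕ m) λ init → Σ ℕ λ k → Σ (Vec ℕ k) λ arr →
          0 < potential arr ×
          c * toℚ (potential arr) ≤ℚ ε * toℚ (migrationCost A C init arr))
theorem16 = ¼ , ¼ , 0<¼ , 0<¼ , λ ε 0<ε ε<¼ →
  let n , d , 0<n , 4n<d , ε*d≡n = below-¼⇒fraction ε 0<ε ε<¼
      ε≤1 = <⇒≤ (<-trans ε<¼ ¼<1)
  in Adversary.forced-migration ε (<⇒≤ 0<ε) ε≤1 n d 0<n 4n<d ε*d≡n
  where
  0<¼ : 0ℚ <ℚ ¼
  0<¼ = *<* (ℤ.+<+ (ℕ.s≤s ℕ.z≤n))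
  ¼<1 : ¼ <ℚ 1ℚ
  ¼<1 = *<* (ℤ.+<+ (ℕ.s≤s (ℕ.s≤s ℕ.z≤n)))
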